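{- For all integers $m,n\ge 2$, ${\rm gp}_{\rm S}(K_m,K_n)=m(n-1)$.
   Context: A set $X$ of vertices of a connected graph is a general position set if no shortest path contains more than two vertices of $X$; ${\rm gp}$ denotes the maximum cardinality of a general position set. For graphs $G,H$ and $f\colon V(G)\to V(H)$, the Sierpiński product $G\otimes_f H$ has vertex set $V(G)\times V(H)$ and edges $(g,h)(g,h')$ for $g\in V(G)$, $hh'\in E(H)$, and $(g,f(g'))(g',f(g))$ for $gg'\in E(G)$. ${\rm gp}_{\rm S}(G,H)=\max_f{\rm gp}(G\otimes_f H)$ over all functions $f\colon V(G)\to V(H)$. $K_m$ is the complete graph on $m$ vertices. -}

module Defs where

open import Level using (0ℓ)
open import Data.Nat using (ℕ; zero; suc; _≤_)
open import Data.Fin using (Fin)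
open import Data.List using (List; []; _∷_; length)
open import Data.List.Membership.Propositional using (_∈_)
open import Data.List.Relation.Unary.Unique.Propositional using (Unique)
open import Data.Product using (_×_; _,_; ∃-syntax)
open import Relation.Binary.PropositionalEquality using (_≡_)
open import Relation.Nullary using (¬_)

Graph : Set → Set₁
Graph V = V → V → Set

K : (m : ℕ) → Graph (Fin m)
K m i j = ¬ (i ≡ j)

data SierpAdj {A B : Set} (G : Graph A) (H : Graph B) (f : A → B)
     : A × B → A × B → Set where
  inner : ∀ {g h h'} → H h h' → SierpAdj G H f (g , h) (g , h')
  outer : ∀ {g g'} → G g g' → SierpAdj G H f (g , f g') (g' , f g)

_⊗[_]_ : {A B : Set} → Graph A → (A → B) → Graph B → Graph (A × B)
G ⊗[ f ] H = SierpAdj G H f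

data Walk {V : Set} (G : Graph V) : V → V → Set where
  [_]  : (u : V) → Walk G u u
  step : ∀ {u w v} → G u w → Walk G w v → Walk G u v

walkLength : ∀ {V} {G : Graph V} {u v} → Walk G u v → ℕ
walkLength [ _ ]      = zero
walkLength (step _ p) = suc (walkLength p)

walkVertices : ∀ {V} {G : Graph V} {u v} → Walk G u v → List V
walkVertices [ u ] = u ∷ []
walkVertices (step {u = u} _ p) = u ∷ walkVertices p

IsShortestPath : ∀ {V} (G : Graph V) {u v} → Walk G u v → Set
IsShortestPath G {u} {v} P = ∀ (Q : Walk G u v) → walkLength P ≤ walkLength Q

IsGPSet : ∀ {V} (G : Graph V) → List V → Set
IsGPSet {V} G X =
  Unique X ×
  (∀ {u v} (P : Walk G u v) → IsShortestPath G P →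
     ¬ (∃[ x ] ∃[ y ] ∃[ z ]
          (x ∈ X × y ∈ X × z ∈ X ×
           ¬ (x ≡ y) × ¬ (y ≡ z) × ¬ (x ≡ z) ×
           x ∈ walkVertices P × y ∈ walkVertices P × z ∈ walkVertices P)))

-- gp_S(G,H) = k : k is the maximum of gp(G ⊗_f H) over all f, i.e.
-- some f admits a general position set of size k, and for every f every
-- general position set of G ⊗_f H has size ≤ k.
GpS≡ : {A B : Set} → Graph A → Graph B → ℕ → Set
GpS≡ {A} {B} G H k =
  (∃[ f ] ∃[ X ] (IsGPSet (G ⊗[ f ] H) X × length X ≡ k)) ×
  (∀ (f : A → B) (X : List (A × B)) → IsGPSet (G ⊗[ f ] H) X → length X ≤ k)

{-# OPTIONS --safe #-}
-- Lower bound: for f constant 0, let X be the vertices (g , h) with h ≠ 0. Two of them in one fibre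
-- {g} × V(K_n) are adjacent, two in different fibres are at distance 3 (through (g , 0) and (g' , 0)),
-- so no vertex of X lies on a shortest walk between two others.
-- Upper bound: if X misses a vertex in every fibre, |X| ≤ m(n - 1). Otherwise X contains a whole
-- fibre g. For (g' , h') ∈ X with g' ≠ g and x ≠ f g', the walk (g' , h') (g' , f g) (g , f g') (g , x)
-- carries three vertices of X, so it is not shortest; this forces h' ≠ f g, x = h' and h' ∈ f(V(K_m)).
-- Hence either X lies in fibre g, or n = 2 and X ⊆ {(g , f g)} ∪ {(g'' , h') : g'' ≠ g₀} with f g₀ = h';
-- both have at most m(n - 1) elements.
module Submission where

open import Defs
open import Data.Nat using (ℕ; zero; suc; _≤_; _*_; _∸_; _+_; z≤n; s≤s)
open import Data.Nat.Properties
  using (≤-trans; +-mono-≤; +-cancelˡ-≤; +-cancelʳ-≤; <-irrefl; m≤m+n; m≤m*n; module ≤-Reasoning)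
open import Data.Fin using (Fin; zero; suc; punchIn; punchOut; _≟_)
open import Data.Fin.Properties using (punchInᵢ≢i; punchIn-injective; punchIn-punchOut; any?; all?; ¬∀⟶∃¬)
open import Data.List using (List; []; _∷_; length; map; allFin; cartesianProductWith)
open import Data.List.Properties using (length-++; length-map; length-tabulate; length-removeAt′)
open import Data.List.Membership.Propositional using (_∈_; _∉_; find)
open import Data.List.Membership.Propositional.Properties
  using (∈-cartesianProductWith⁺; ∈-cartesianProductWith⁻; ∈-allFin; ∈-map⁺)
import Data.List.Membership.DecPropositional as DecMembership
open import Data.List.Relation.Binary.Subset.Propositional using (_⊆_)
open import Data.List.Relation.Unary.Any using (here; there; index; _─_)
import Data.List.Relation.Unary.All as All
open import Data.List.Relation.Unary.All.Properties using (¬All⇒Any¬)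
open import Data.List.Relation.Unary.AllPairs using ([]; _∷_)
open import Data.List.Relation.Unary.Unique.Propositional using (Unique)
open import Data.List.Relation.Unary.Unique.Propositional.Properties using (cartesianProductWith⁺; allFin⁺)
open import Data.Product using (_×_; _,_; proj₁; proj₂; ∃; ∃₂; ∃-syntax)
open import Data.Product.Properties using (,-injectiveˡ; ,-injectiveʳ; ≡-dec)
open import Data.Sum using (_⊎_; inj₁; inj₂; [_,_]′)
import Data.Sum as Sum
open import Data.Empty using (⊥; ⊥-elim)
open import Function using (_∘_; id)
open import Relation.Binary.PropositionalEquality
  using (_≡_; _≢_; refl; sym; trans; cong; cong₂; subst; ≢-sym)
open import Relation.Nullary using (¬_; Dec; yes; no)
open import Relation.Nullary.Decidable using (decidable-stable; _×-dec_)

module _ {A : Set} where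

  ∈-─⁺ : ∀ {x z : A} {ys} (x∈ys : x ∈ ys) → z ∈ ys → z ≢ x → z ∈ (ys ─ x∈ys)
  ∈-─⁺ (here refl)  (here refl)  z≢x = ⊥-elim (z≢x refl)
  ∈-─⁺ (here _)     (there z∈ys) _   = z∈ys
  ∈-─⁺ (there _)    (here z≡y)   _   = here z≡y
  ∈-─⁺ (there x∈ys) (there z∈ys) z≢x = there (∈-─⁺ x∈ys z∈ys z≢x)

  unique-⊆⇒length≤ : ∀ {xs ys : List A} → Unique xs → xs ⊆ ys → length xs ≤ length ys
  unique-⊆⇒length≤ []                         _     = z≤n
  unique-⊆⇒length≤ {x ∷ xs} {ys} (x∉xs ∷ xs!) xs⊆ys = begin
    suc (length xs)          ≤⟨ s≤s (unique-⊆⇒length≤ xs! xs⊆ys─x) ⟩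
    suc (length (ys ─ x∈ys)) ≡⟨ length-removeAt′ ys (index x∈ys) ⟨
    length ys                ∎
    where
    open ≤-Reasoning
    x∈ys : x ∈ ys
    x∈ys = xs⊆ys (here refl)
    xs⊆ys─x : xs ⊆ (ys ─ x∈ys)
    xs⊆ys─x z∈xs = ∈-─⁺ x∈ys (xs⊆ys (there z∈xs)) (All.lookup x∉xs z∈xs ∘ sym)

length-cartesianProductWith : ∀ {A B C : Set} (f : A → B → C) (xs : List A) (ys : List B) →
                              length (cartesianProductWith f xs ys) ≡ length xs * length ys
length-cartesianProductWith f []       ys = refl
length-cartesianProductWith f (x ∷ xs) ys = trans (length-++ (map (f x) ys))
  (cong₂ _+_ (length-map (f x) ys) (length-cartesianProductWith f xs ys))

allFinExcept : ∀ {n} → Fin (suc n) → List (Fin (suc n))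
allFinExcept {n} i = map (punchIn i) (allFin n)

length-allFinExcept : ∀ {n} (i : Fin (suc n)) → length (allFinExcept i) ≡ n
length-allFinExcept {n} i = trans (length-map (punchIn i) (allFin n)) (length-tabulate id)

∈-allFinExcept : ∀ {n} {i j : Fin (suc n)} → i ≢ j → j ∈ allFinExcept i
∈-allFinExcept {i = i} i≢j =
  subst (_∈ allFinExcept i) (punchIn-punchOut i≢j) (∈-map⁺ (punchIn i) (∈-allFin (punchOut i≢j)))

inFibre⇒length≤ : ∀ {A : Set} {n} {g : A} {X : List (A × Fin n)} →
                  Unique X → All.All ((_≡ g) ∘ proj₁) X → length X ≤ n
inFibre⇒length≤ {n = n} {g} {X} X! inFibre = begin
  length X                       ≤⟨ unique-⊆⇒length≤ X! X⊆fibre ⟩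
  length (map (g ,_) (allFin n)) ≡⟨ trans (length-map (g ,_) (allFin n)) (length-tabulate id) ⟩
  n                              ∎
  where
  open ≤-Reasoning
  X⊆fibre : X ⊆ map (g ,_) (allFin n)
  X⊆fibre {_ , h} h∈X with refl ← All.lookup inFibre h∈X = ∈-map⁺ (g ,_) (∈-allFin h)

module _ {m n : ℕ} where

  offHoles : (Fin m → Fin (suc n)) → List (Fin m × Fin (suc n))
  offHoles hole = cartesianProductWith (λ g k → g , punchIn (hole g) k) (allFin m) (allFin n)

  offHoles-unique : ∀ hole → Unique (offHoles hole)
  offHoles-unique hole = cartesianProductWith⁺ _ injective (allFin⁺ m) (allFin⁺ n)
    where
    injective : ∀ {g g' k k'} → (g , punchIn (hole g) k) ≡ (g' , punchIn (hole g') k') →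
                g ≡ g' × k ≡ k'
    injective eq with refl ← ,-injectiveˡ eq = refl , punchIn-injective _ _ _ (,-injectiveʳ eq)

  length-offHoles : ∀ hole → length (offHoles hole) ≡ m * n
  length-offHoles hole = trans (length-cartesianProductWith _ (allFin m) (allFin n))
                               (cong₂ _*_ (length-tabulate {n = m} id) (length-tabulate {n = n} id))

  ∈-offHoles⁺ : ∀ {hole g h} → hole g ≢ h → (g , h) ∈ offHoles hole
  ∈-offHoles⁺ {hole} {g} hole≢h = subst (λ h → (g , h) ∈ offHoles hole) (punchIn-punchOut hole≢h)
    (∈-cartesianProductWith⁺ _ (∈-allFin g) (∈-allFin (punchOut hole≢h)))

  ∈-offHoles⁻ : ∀ hole {v} → v ∈ offHoles hole → ∃₂ λ g h → v ≡ (g , h) × hole g ≢ h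
  ∈-offHoles⁻ hole v∈
    with g , k , _ , _ , refl ← ∈-cartesianProductWith⁻ _ (allFin m) (allFin n) v∈ =
    g , punchIn (hole g) k , refl , ≢-sym (punchInᵢ≢i (hole g) k)

  missingInEachFibre⇒length≤ : ∀ {X} → Unique X → (∀ g → ∃[ h ] (g , h) ∉ X) → length X ≤ m * n
  missingInEachFibre⇒length≤ {X} X! missing = begin
    length X               ≤⟨ unique-⊆⇒length≤ X! X⊆offHoles ⟩
    length (offHoles hole) ≡⟨ length-offHoles hole ⟩
    m * n                  ∎
    where
    open ≤-Reasoning
    hole : Fin m → Fin (suc n)
    hole g = proj₁ (missing g)
    X⊆offHoles : X ⊆ offHoles hole
    X⊆offHoles {g , h} h∈X =
      ∈-offHoles⁺ λ hole≡h → proj₂ (missing g) (subst (λ h → (g , h) ∈ X) (sym hole≡h) h∈X)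

module _ {V : Set} {G : Graph V} where

  infixr 5 _++ʷ_

  _++ʷ_ : ∀ {u w v} → Walk G u w → Walk G w v → Walk G u v
  [ _ ]    ++ʷ Q = Q
  step e P ++ʷ Q = step e (P ++ʷ Q)

  length-++ʷ : ∀ {u w v} (P : Walk G u w) (Q : Walk G w v) →
               walkLength (P ++ʷ Q) ≡ walkLength P + walkLength Q
  length-++ʷ [ _ ]      Q = refl
  length-++ʷ (step _ P) Q = cong suc (length-++ʷ P Q)

  ++ʷ-assoc : ∀ {u v w x} (P : Walk G u v) (Q : Walk G v w) (R : Walk G w x) →
              (P ++ʷ Q) ++ʷ R ≡ P ++ʷ Q ++ʷ R
  ++ʷ-assoc [ _ ]      Q R = refl
  ++ʷ-assoc (step e P) Q R = cong (step e) (++ʷ-assoc P Q R)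

  start∈walkVertices : ∀ {u v} (P : Walk G u v) → u ∈ walkVertices P
  start∈walkVertices [ _ ]      = here refl
  start∈walkVertices (step _ _) = here refl

  ∈-++ʷ⁺ʳ : ∀ {u w v x} (P : Walk G u w) {Q : Walk G w v} →
            x ∈ walkVertices Q → x ∈ walkVertices (P ++ʷ Q)
  ∈-++ʷ⁺ʳ [ _ ]      x∈Q = x∈Q
  ∈-++ʷ⁺ʳ (step _ P) x∈Q = there (∈-++ʷ⁺ʳ P x∈Q)

  ∈-++ʷ⁻ : ∀ {u w v x} (P : Walk G u w) {Q : Walk G w v} →
           x ∈ walkVertices (P ++ʷ Q) → x ∈ walkVertices P ⊎ x ∈ walkVertices Q
  ∈-++ʷ⁻ [ _ ]      x∈Q         = inj₂ x∈Q
  ∈-++ʷ⁻ (step _ P) (here x≡u)  = inj₁ (here x≡u)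
  ∈-++ʷ⁻ (step _ P) (there x∈)  = Sum.map₁ there (∈-++ʷ⁻ P x∈)

  splitAt : ∀ {u v x} (P : Walk G u v) → x ∈ walkVertices P →
            ∃₂ λ (A : Walk G u x) (B : Walk G x v) → P ≡ A ++ʷ B
  splitAt [ u ]      (here refl) = [ u ] , [ u ] , refl
  splitAt (step e P) (here refl) = [ _ ] , step e P , refl
  splitAt (step e P) (there x∈P) =
    let A , B , P≡AB = splitAt P x∈P in step e A , B , cong (step e) P≡AB

  shortest-infix : ∀ {u a b v} (A : Walk G u a) (M : Walk G a b) (D : Walk G b v) →
                   IsShortestPath G (A ++ʷ M ++ʷ D) → IsShortestPath G M
  shortest-infix A M D sh Q =
    +-cancelʳ-≤ (walkLength D) _ _ (+-cancelˡ-≤ (walkLength A) _ _ (begin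
      walkLength A + (walkLength M + walkLength D) ≡⟨ length-++ʷ³ M ⟨
      walkLength (A ++ʷ M ++ʷ D)                   ≤⟨ sh (A ++ʷ Q ++ʷ D) ⟩
      walkLength (A ++ʷ Q ++ʷ D)                   ≡⟨ length-++ʷ³ Q ⟩
      walkLength A + (walkLength Q + walkLength D) ∎))
    where
    open ≤-Reasoning
    length-++ʷ³ : (N : Walk G _ _) →
                  walkLength (A ++ʷ N ++ʷ D) ≡ walkLength A + (walkLength N + walkLength D)
    length-++ʷ³ N = trans (length-++ʷ A (N ++ʷ D)) (cong (walkLength A +_) (length-++ʷ N D))

  Between : V → V → V → Set
  Between a b c = ∃₂ λ (B : Walk G a b) (C : Walk G b c) → IsShortestPath G (B ++ʷ C)

  shortest-++ʷ⇒length≤ : ∀ {a b c} (B : Walk G a b) (C : Walk G b c) → IsShortestPath G (B ++ʷ C) →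
                 (Q : Walk G a c) → walkLength B + walkLength C ≤ walkLength Q
  shortest-++ʷ⇒length≤ B C sh Q = subst (_≤ walkLength Q) (length-++ʷ B C) (sh Q)

  Ordered : ∀ {u v} → Walk G u v → V → V → Set
  Ordered {u} {v} P a b =
    ∃₂ λ (A : Walk G u a) (M : Walk G a b) → ∃ λ (D : Walk G b v) → P ≡ A ++ʷ M ++ʷ D

  Ordered₃ : ∀ {u v} → Walk G u v → V → V → V → Set
  Ordered₃ {u} {v} P a b c =
    ∃₂ λ (A : Walk G u a) (M : Walk G a b) →
    ∃₂ λ (N : Walk G b c) (D : Walk G c v) → P ≡ A ++ʷ M ++ʷ N ++ʷ D

  order : ∀ {u v a b} (P : Walk G u v) → a ∈ walkVertices P → b ∈ walkVertices P →
          Ordered P a b ⊎ Ordered P b a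
  order P a∈P b∈P with A , B , refl ← splitAt P a∈P with ∈-++ʷ⁻ A b∈P
  ... | inj₂ b∈B = let M , D , B≡MD = splitAt B b∈B in
    inj₁ (A , M , D , cong (A ++ʷ_) B≡MD)
  ... | inj₁ b∈A = let A₁ , A₂ , A≡A₁A₂ = splitAt A b∈A in
    inj₂ (A₁ , A₂ , B , trans (cong (_++ʷ B) A≡A₁A₂) (++ʷ-assoc A₁ A₂ B))

  order₃ : ∀ {u v a b c} {P : Walk G u v} → Ordered P a b → c ∈ walkVertices P →
           Ordered₃ P c a b ⊎ Ordered₃ P a c b ⊎ Ordered₃ P a b c
  order₃ (A , M , D , refl) c∈P with ∈-++ʷ⁻ A c∈P
  ... | inj₁ c∈A = let A₁ , A₂ , A≡A₁A₂ = splitAt A c∈A in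
    inj₁ (A₁ , A₂ , M , D , trans (cong (_++ʷ M ++ʷ D) A≡A₁A₂) (++ʷ-assoc A₁ A₂ _))
  ... | inj₂ c∈MD with ∈-++ʷ⁻ M c∈MD
  ...   | inj₁ c∈M = let M₁ , M₂ , M≡M₁M₂ = splitAt M c∈M in
    inj₂ (inj₁ (A , M₁ , M₂ , D , cong (A ++ʷ_) (trans (cong (_++ʷ D) M≡M₁M₂) (++ʷ-assoc M₁ M₂ D))))
  ...   | inj₂ c∈D = let D₁ , D₂ , D≡D₁D₂ = splitAt D c∈D in
    inj₂ (inj₂ (A , M , D₁ , D₂ , cong (λ D′ → A ++ʷ M ++ʷ D′) D≡D₁D₂))

  ordered₃⇒between : ∀ {u v a b c} {P : Walk G u v} →
                     IsShortestPath G P → Ordered₃ P a b c → Between a b c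
  ordered₃⇒between sh (A , M , N , D , refl) =
    M , N , shortest-infix A (M ++ʷ N) D
              (subst (IsShortestPath G) (cong (A ++ʷ_) (sym (++ʷ-assoc M N D))) sh)

  NoneBetween : List V → Set
  NoneBetween X = ∀ {a b c} → a ∈ X → b ∈ X → c ∈ X → a ≢ b → b ≢ c → a ≢ c → ¬ Between a b c

  noneBetween⇒IsGPSet : ∀ {X} → Unique X → NoneBetween X → IsGPSet G X
  noneBetween⇒IsGPSet {X} X! none =
    X! , λ P sh (_ , _ , _ , x∈X , y∈X , z∈X , x≢y , y≢z , x≢z , x∈P , y∈P , z∈P) →
      [ (λ xy → third sh xy x∈X y∈X z∈X x≢y y≢z x≢z z∈P)
      , (λ yx → third sh yx y∈X x∈X z∈X (≢-sym x≢y) x≢z y≢z z∈P)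
      ]′ (order P x∈P y∈P)
    where
    third : ∀ {u v a b c} {P : Walk G u v} → IsShortestPath G P → Ordered P a b →
            a ∈ X → b ∈ X → c ∈ X → a ≢ b → b ≢ c → a ≢ c → c ∈ walkVertices P → ⊥
    third sh ab a∈X b∈X c∈X a≢b b≢c a≢c c∈P with order₃ ab c∈P
    ... | inj₁ cab        = none c∈X a∈X b∈X (≢-sym a≢c) a≢b (≢-sym b≢c) (ordered₃⇒between sh cab)
    ... | inj₂ (inj₁ acb) = none a∈X c∈X b∈X a≢c (≢-sym b≢c) a≢b (ordered₃⇒between sh acb)
    ... | inj₂ (inj₂ abc) = none a∈X b∈X c∈X a≢b b≢c a≢c (ordered₃⇒between sh abc)

  walkLength≥1 : ∀ {u v} → u ≢ v → (Q : Walk G u v) → 1 ≤ walkLength Q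
  walkLength≥1 u≢u [ _ ]      = ⊥-elim (u≢u refl)
  walkLength≥1 _   (step _ _) = s≤s z≤n

  walkLength≥2 : ∀ {u v} → u ≢ v → ¬ G u v → (Q : Walk G u v) → 2 ≤ walkLength Q
  walkLength≥2 u≢u _    [ _ ]                = ⊥-elim (u≢u refl)
  walkLength≥2 _   ¬u~v (step u~v [ _ ])     = ⊥-elim (¬u~v u~v)
  walkLength≥2 _   _    (step _ (step _ _)) = s≤s (s≤s z≤n)

  walkLength≥3 : ∀ {u v} → u ≢ v → ¬ G u v → (∀ {w} → G u w → G w v → ⊥) →
                 (Q : Walk G u v) → 3 ≤ walkLength Q
  walkLength≥3 u≢u _    _      [ _ ]                         = ⊥-elim (u≢u refl)
  walkLength≥3 _   ¬u~v _      (step u~v [ _ ])              = ⊥-elim (¬u~v u~v)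
  walkLength≥3 _   _    ¬u~w~v (step u~w (step w~v [ _ ]))   = ⊥-elim (¬u~w~v u~w w~v)
  walkLength≥3 _   _    _      (step _ (step _ (step _ _)))  = s≤s (s≤s (s≤s z≤n))

⊗-adjacent⁻ : ∀ {A B : Set} {G : Graph A} {H : Graph B} {f : A → B} {g g' h h'} →
              (G ⊗[ f ] H) (g , h) (g' , h') → (g ≡ g' × H h h') ⊎ (G g g' × h ≡ f g' × h' ≡ f g)
⊗-adjacent⁻ (inner h~h') = inj₁ (refl , h~h')
⊗-adjacent⁻ (outer g~g') = inj₂ (g~g' , refl , refl)

module _ {m n : ℕ} (f : Fin m → Fin n) where

  ⊗-nonadjacent : ∀ {g g' h h'} → g ≢ g' → h' ≢ f g → ¬ (K m ⊗[ f ] K n) (g , h) (g' , h')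
  ⊗-nonadjacent g≢g' h'≢fg e with ⊗-adjacent⁻ e
  ... | inj₁ (g≡g' , _)      = g≢g' g≡g'
  ... | inj₂ (_ , _ , h'≡fg) = h'≢fg h'≡fg

  -- The last hypothesis excludes the walk (g , f g″) (g″ , f g) (g' , f g″) along two outer edges.
  ⊗-noCommonNeighbour : ∀ {g g' h h'} → g ≢ g' → h ≢ f g' → h' ≢ f g → ¬ (h' ≡ h × ∃[ g″ ] f g″ ≡ h) →
                        ∀ {w} → (K m ⊗[ f ] K n) (g , h) w → (K m ⊗[ f ] K n) w (g' , h') → ⊥
  ⊗-noCommonNeighbour g≢g' h≢fg' h'≢fg ¬h'≡h∈img {gw , _} e₁ e₂ with ⊗-adjacent⁻ e₁ | ⊗-adjacent⁻ e₂
  ... | inj₁ (refl , _)       | inj₁ (refl , _)        = g≢g' refl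
  ... | inj₁ (refl , _)       | inj₂ (_ , _ , h'≡fg)   = h'≢fg h'≡fg
  ... | inj₂ (_ , h≡fgw , _)  | inj₁ (refl , _)        = h≢fg' h≡fgw
  ... | inj₂ (_ , h≡fgw , _)  | inj₂ (_ , _ , h'≡fgw) =
    ¬h'≡h∈img (trans h'≡fgw (sym h≡fgw) , gw , sym h≡fgw)

  ⊗-walkLength≥2 : ∀ {g g' h h'} → g ≢ g' → h' ≢ f g →
                   (Q : Walk (K m ⊗[ f ] K n) (g , h) (g' , h')) → 2 ≤ walkLength Q
  ⊗-walkLength≥2 g≢g' h'≢fg = walkLength≥2 (g≢g' ∘ ,-injectiveˡ) (⊗-nonadjacent g≢g' h'≢fg)

  ⊗-walkLength≥3 : ∀ {g g' h h'} → g ≢ g' → h ≢ f g' → h' ≢ f g → ¬ (h' ≡ h × ∃[ g″ ] f g″ ≡ h) →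
                   (Q : Walk (K m ⊗[ f ] K n) (g , h) (g' , h')) → 3 ≤ walkLength Q
  ⊗-walkLength≥3 g≢g' h≢fg' h'≢fg ¬h'≡h∈img =
    walkLength≥3 (g≢g' ∘ ,-injectiveˡ) (⊗-nonadjacent g≢g' h'≢fg)
                 (⊗-noCommonNeighbour g≢g' h≢fg' h'≢fg ¬h'≡h∈img)

module _ {m n : ℕ} where

  private
    f₀ : Fin m → Fin (suc n)
    f₀ _ = zero

  offZero-far : ∀ {g g' h h'} → g ≢ g' → zero ≢ h → zero ≢ h' →
                (Q : Walk (K m ⊗[ f₀ ] K (suc n)) (g , h) (g' , h')) → 3 ≤ walkLength Q
  offZero-far g≢g' 0≢h 0≢h' = ⊗-walkLength≥3 f₀ g≢g' (≢-sym 0≢h) (≢-sym 0≢h') λ (_ , _ , 0≡h) → 0≢h 0≡h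

  offZero-noneBetween : NoneBetween {G = K m ⊗[ f₀ ] K (suc n)} (offHoles f₀)
  offZero-noneBetween a∈ b∈ c∈ a≢b b≢c a≢c (B , C , sh)
    with ga , ha , refl , 0≢ha ← ∈-offHoles⁻ f₀ a∈
       | gb , hb , refl , 0≢hb ← ∈-offHoles⁻ f₀ b∈
       | gc , hc , refl , 0≢hc ← ∈-offHoles⁻ f₀ c∈
       | ga ≟ gc
  ... | yes refl = <-irrefl refl (≤-trans (+-mono-≤ (walkLength≥1 a≢b B) (walkLength≥1 b≢c C))
                                          (shortest-++ʷ⇒length≤ B C sh a→c))
    where
    a→c : Walk (K m ⊗[ f₀ ] K (suc n)) (ga , ha) (ga , hc)
    a→c = step (inner (a≢c ∘ cong (ga ,_))) [ _ ]
  ... | no ga≢gc = <-irrefl refl (≤-trans (B+C≥4 (gb ≟ ga))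
                                          (shortest-++ʷ⇒length≤ B C sh a→0→0→c))
    where
    a→0→0→c : Walk (K m ⊗[ f₀ ] K (suc n)) (ga , ha) (gc , hc)
    a→0→0→c = step (inner (≢-sym 0≢ha)) (step (outer ga≢gc) (step (inner 0≢hc) [ _ ]))
    B+C≥4 : Dec (gb ≡ ga) → 4 ≤ walkLength B + walkLength C
    B+C≥4 (yes refl)  = +-mono-≤ (walkLength≥1 a≢b B) (offZero-far ga≢gc 0≢hb 0≢hc C)
    B+C≥4 (no gb≢ga) = +-mono-≤ (offZero-far (≢-sym gb≢ga) 0≢ha 0≢hb B) (walkLength≥1 b≢c C)

  gp-lower : ∃[ f ] ∃[ X ] (IsGPSet (K m ⊗[ f ] K (suc n)) X × length X ≡ m * n)
  gp-lower = f₀ , offHoles f₀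
           , noneBetween⇒IsGPSet (offHoles-unique f₀) offZero-noneBetween , length-offHoles f₀

module _ {m n : ℕ} {f : Fin (2 + m) → Fin (2 + n)} {X : List (Fin (2 + m) × Fin (2 + n))}
         (X-gp : IsGPSet (K (2 + m) ⊗[ f ] K (2 + n)) X) where

  private
    S : Graph (Fin (2 + m) × Fin (2 + n))
    S = K (2 + m) ⊗[ f ] K (2 + n)

  FullFibre : Fin (2 + m) → Set
  FullFibre g = ∀ h → (g , h) ∈ X

  fullFibre-entry-notShortest : ∀ {g g' h x} → FullFibre g → (g' , h) ∈ X →
    (g'≢g : g' ≢ g) (x≢fg' : x ≢ f g') (W : Walk S (g' , h) (g' , f g)) →
    ¬ IsShortestPath S (W ++ʷ step (outer g'≢g) (step (inner (≢-sym x≢fg')) [ (g , x) ]))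
  fullFibre-entry-notShortest {g' = g'} {x = x} full h∈X g'≢g x≢fg' W sh =
    proj₂ X-gp _ sh ( _ , _ , _ , h∈X , full (f g') , full x
                    , g'≢g ∘ ,-injectiveˡ , x≢fg' ∘ sym ∘ ,-injectiveʳ , g'≢g ∘ ,-injectiveˡ
                    , start∈walkVertices (W ++ʷ _)
                    , ∈-++ʷ⁺ʳ W (there (here refl)) , ∈-++ʷ⁺ʳ W (there (there (here refl))))

  fullFibre-avoids : ∀ {g g' h'} → FullFibre g → (g' , h') ∈ X → g' ≢ g → h' ≢ f g
  fullFibre-avoids {g' = g'} full h'∈X g'≢g refl =
    fullFibre-entry-notShortest full h'∈X g'≢g x≢fg' [ _ ] (⊗-walkLength≥2 f g'≢g x≢fg')
    where x≢fg' = punchInᵢ≢i (f g') zero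

  fullFibre-outside : ∀ {g g' h' x} → FullFibre g → (g' , h') ∈ X → g' ≢ g → x ≢ f g' →
                      x ≡ h' × ∃[ g″ ] f g″ ≡ h'
  fullFibre-outside {h' = h'} {x} full h'∈X g'≢g x≢fg' =
    decidable-stable (x ≟ h' ×-dec any? (λ g″ → f g″ ≟ h')) λ ¬x≡h'∈img →
      fullFibre-entry-notShortest full h'∈X g'≢g x≢fg' (step (inner h'≢fg) [ _ ])
        (⊗-walkLength≥3 f g'≢g h'≢fg x≢fg' ¬x≡h'∈img)
    where h'≢fg = fullFibre-avoids full h'∈X g'≢g

  fullFibre-f-constant : ∀ {g g₂ h₂} → FullFibre g → (g₂ , h₂) ∈ X → f g₂ ≡ f g
  fullFibre-f-constant {g} {g₂} full h₂∈X with g₂ ≟ g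
  ... | yes refl = refl
  ... | no g₂≢g = decidable-stable (f g₂ ≟ f g) λ fg₂≢fg →
        fullFibre-avoids full h₂∈X g₂≢g (sym (proj₁ (fullFibre-outside full h₂∈X g₂≢g (≢-sym fg₂≢fg))))

  fullFibre-outside⇒length≤ : ∀ {g g' h'} → FullFibre g → (g' , h') ∈ X → g' ≢ g → length X ≤ 2 + m
  fullFibre-outside⇒length≤ {g} {g'} {h'} full h'∈X g'≢g = begin
    length X ≤⟨ unique-⊆⇒length≤ (proj₁ X-gp) X⊆Y ⟩
    length Y ≡⟨ cong suc (trans (length-map (_, h') (allFinExcept g″)) (length-allFinExcept g″)) ⟩
    2 + m    ∎
    where
    open ≤-Reasoning
    h'∈img : ∃[ g″ ] f g″ ≡ h'
    h'∈img = proj₂ (fullFibre-outside full h'∈X g'≢g (punchInᵢ≢i (f g') zero))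
    g″ = proj₁ h'∈img
    h'≢fg = fullFibre-avoids full h'∈X g'≢g
    Y = (g , f g) ∷ map (_, h') (allFinExcept g″)
    -- f is constant (= f g ≠ h') on the fibres meeting X, so fibre g″ does not meet X.
    X⊆Y : X ⊆ Y
    X⊆Y {g₂ , h₂} h₂∈X with h₂ ≟ f g
    ... | yes refl =
      here (cong (_, f g) (decidable-stable (g₂ ≟ g) λ g₂≢g → fullFibre-avoids full h₂∈X g₂≢g refl))
    ... | no h₂≢fg = there (subst (λ h → (g₂ , h) ∈ _) (sym h₂≡h') (∈-map⁺ (_, h') (∈-allFinExcept g″≢g₂)))
      where
      h₂≡h' : h₂ ≡ h'
      h₂≡h' = proj₁ (fullFibre-outside full h'∈X g'≢g λ h₂≡fg' →
                       h₂≢fg (trans h₂≡fg' (fullFibre-f-constant full h'∈X)))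
      g″≢g₂ : g″ ≢ g₂
      g″≢g₂ refl = h'≢fg (trans (sym (proj₂ h'∈img)) (fullFibre-f-constant full h₂∈X))

  fullFibre⇒length≤ : ∀ {g} → FullFibre g → length X ≤ (2 + m) * (1 + n)
  fullFibre⇒length≤ {g} full with All.all? (λ v → proj₁ v ≟ g) X
  ... | yes inFibre =
    ≤-trans (inFibre⇒length≤ (proj₁ X-gp) inFibre) (+-mono-≤ (s≤s z≤n) (m≤m+n (1 + n) (m * (1 + n))))
  ... | no ¬inFibre with (g' , h') , h'∈X , g'≢g ← find (¬All⇒Any¬ (λ v → proj₁ v ≟ g) X ¬inFibre) =
    ≤-trans (fullFibre-outside⇒length≤ full h'∈X g'≢g) (m≤m*n (2 + m) (1 + n))

private
  _∈?_ : ∀ {m n} (v : Fin m × Fin n) (X : List (Fin m × Fin n)) → Dec (v ∈ X)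
  _∈?_ = DecMembership._∈?_ (≡-dec _≟_ _≟_)

gp-upper : ∀ {m n} (f : Fin (2 + m) → Fin (2 + n)) X → IsGPSet (K (2 + m) ⊗[ f ] K (2 + n)) X →
           length X ≤ (2 + m) * (1 + n)
gp-upper f X X-gp with any? (λ g → all? (λ h → (g , h) ∈? X))
... | yes (g , full) = fullFibre⇒length≤ X-gp full
... | no ¬full =
  missingInEachFibre⇒length≤ (proj₁ X-gp) λ g → ¬∀⟶∃¬ _ _ (λ h → (g , h) ∈? X) (¬full ∘ (g ,_))

theorem5p1 : ∀ (m n : ℕ) → 2 ≤ m → 2 ≤ n → GpS≡ (K m) (K n) (m * (n ∸ 1))
theorem5p1 (suc (suc m)) (suc (suc n)) _ _ = gp-lower , gp-upper
theorem5p1 0             _             ()          _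
theorem5p1 1             _             (s≤s ())    _
theorem5p1 (suc (suc m)) 0             _           ()
theorem5p1 (suc (suc m)) 1             _           (s≤s ())
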